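{- For all $n\ge 4$, $\det(AQ_n)\le 3$.
   Context: The augmented hypercube $AQ_n$ has vertex set $\mathbb{Z}_2^n$; two vertices are adjacent iff either they differ in exactly one position, or for some $0\le \ell\le n-2$ they agree in the first $\ell$ positions and differ in all of the remaining $n-\ell$ positions. A determining set of a graph is a vertex set such that the only automorphism fixing each of its vertices is the identity; $\det$ is the minimum size of a determining set. -}

module Defs where

open import Data.Nat using (ℕ; _+_; _<_; _≤_)
open import Data.Fin using (Fin; toℕ)
open import Data.Bool using (Bool)
open import Data.Vec using (Vec; lookup)
open import Data.List using (List; length)
open import Data.List.Membership.Propositional using (_∈_)
open import Data.Product using (Σ; ∃; _×_)
open import Data.Sum using (_⊎_)
open import Function.Bundles using (_↔_; Inverse)
open import Relation.Binary.PropositionalEquality using (_≡_; _≢_)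
open import Relation.Nullary using (¬_)

-- vertices of AQ_n : binary strings of length n (positions indexed 0..n-1)
Vertex : ℕ → Set
Vertex n = Vec Bool n

HypercubeAdj : ∀ {n} → Vertex n → Vertex n → Set
HypercubeAdj {n} u v =
  Σ (Fin n) λ i → (lookup u i ≢ lookup v i) ×
    ((j : Fin n) → j ≢ i → lookup u j ≡ lookup v j)

ComplementAdj : ∀ {n} → Vertex n → Vertex n → Set
ComplementAdj {n} u v =
  Σ ℕ λ ℓ → (ℓ + 2 ≤ n) ×
    ((i : Fin n) → (toℕ i < ℓ → lookup u i ≡ lookup v i) ×
                   (ℓ ≤ toℕ i → lookup u i ≢ lookup v i))

AQAdj : ∀ {n} → Vertex n → Vertex n → Set
AQAdj u v = HypercubeAdj u v ⊎ ComplementAdj u v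

record Automorphism (n : ℕ) : Set where
  field
    perm     : Vertex n ↔ Vertex n
    preserve : ∀ u v → AQAdj u v → AQAdj (Inverse.to perm u) (Inverse.to perm v)
    reflect  : ∀ u v → AQAdj (Inverse.to perm u) (Inverse.to perm v) → AQAdj u v

IsDeterminingSet : (n : ℕ) → List (Vertex n) → Set
IsDeterminingSet n S =
  (φ : Automorphism n) →
  ((s : Vertex n) → s ∈ S → Inverse.to (Automorphism.perm φ) s ≡ s) →
  (v : Vertex n) → Inverse.to (Automorphism.perm φ) v ≡ v

DetAtMost : (n k : ℕ) → Set
DetAtMost n k = Σ (List (Vertex n)) λ S → (length S ≤ k) × IsDeterminingSet n S

module Submission where

-- AQ_n is the Cayley graph of (ℤ₂)ⁿ generated by the unit vectors e_a and the vectors c_ℓ,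
-- ℓ ≤ n − 2, with ones exactly at the positions ≥ ℓ (and c_{n−1} = e_{n−1}).  Call x anchored
-- for an automorphism φ if φ fixes x, x ⊕ c₀ and x ⊕ e_{n−1}.  Then φ fixes every neighbour of
-- an anchored x, because each is singled out by adjacencies to vertices already fixed: by
-- induction on i, x ⊕ c_{i+1} is recognised among the common neighbours of x and x ⊕ c_i; x ⊕ e_i
-- is the only common neighbour of x, x ⊕ c_i and x ⊕ c_{i+1}; and x ⊕ c₀ ⊕ e_{n−1} is the only
-- common neighbour of x ⊕ c₀ and x ⊕ e_{n−1} besides x.  Hence anchored vertices have anchored
-- neighbours, and if φ fixes 0, c₀ and e_{n−1}, then 0 is anchored and φ is the identity.

open import Data.Bool using (Bool; true; false; _xor_)
open import Data.Bool.Properties using (xor-comm; xor-assoc; xor-same; xor-identityʳ)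
open import Data.Empty using (⊥; ⊥-elim)
open import Data.Fin using (Fin; toℕ; fromℕ<)
open import Data.Fin.Properties using (toℕ-fromℕ<; toℕ<n; toℕ-injective)
open import Data.List using (List; []; _∷_)
open import Data.List.Relation.Unary.Any using (here; there)
open import Data.Nat using (ℕ; zero; suc; _+_; _≤_; _<_; z≤n; s≤s; _≟_; _≤?_)
open import Data.Nat.Properties
  using (≤-refl; ≤-trans; ≤-antisym; ≤-reflexive; ≤-pred; n≤1+n; m≤n⇒m≤1+n; m≤n⇒m<n∨m≡n; <⇒≤; <⇒≱; ≰⇒>;
         <-cmp; +-comm; 1+n≢0; 1+n≢n; 1+n≰n; m+1+n≢n; n≤0⇒n≡0)
open import Data.Product using (Σ; _×_; _,_; proj₁; proj₂)
open import Data.Sum using (_⊎_; inj₁; inj₂)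
open import Data.Vec using (Vec; []; _∷_; lookup)
open import Function using (case_of_)
open import Function.Bundles using (mk⇔; Inverse; Injection)
open import Function.Properties.Inverse using (↔⇒↣)
open import Relation.Binary.Definitions using (tri<; tri≈; tri>)
open import Relation.Binary.PropositionalEquality
open import Relation.Nullary using (¬_; Dec; yes; no; does; ¬?)
open import Relation.Nullary.Decidable using (dec-true; dec-false; does-⇔)

open import Defs

-- The group (ℤ₂)ⁿ

tabulateℕ : ∀ {n} → (ℕ → Bool) → Vertex n
tabulateℕ {zero}  f = []
tabulateℕ {suc n} f = f 0 ∷ tabulateℕ (λ k → f (suc k))

bit : ∀ {n} → Vertex n → ℕ → Bool
bit []      k       = false
bit (b ∷ v) zero    = b
bit (b ∷ v) (suc k) = bit v k

bit-tabulateℕ : ∀ {n} f k → k < n → bit (tabulateℕ {n} f) k ≡ f k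
bit-tabulateℕ {suc n} f zero    _         = refl
bit-tabulateℕ {suc n} f (suc k) (s≤s k<n) = bit-tabulateℕ (λ j → f (suc j)) k k<n

lookup≡bit : ∀ {n} (v : Vertex n) (i : Fin n) → lookup v i ≡ bit v (toℕ i)
lookup≡bit (b ∷ v) Fin.zero    = refl
lookup≡bit (b ∷ v) (Fin.suc i) = lookup≡bit v i

≡-by-bits : ∀ {n} {u v : Vertex n} → (∀ k → k < n → bit u k ≡ bit v k) → u ≡ v
≡-by-bits {u = []}    {[]}    _ = refl
≡-by-bits {u = a ∷ u} {b ∷ v} h =
  cong₂ _∷_ (h 0 (s≤s z≤n)) (≡-by-bits (λ k k<n → h (suc k) (s≤s k<n)))

zeros : ∀ {n} → Vertex n
zeros = tabulateℕ (λ _ → false)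

infixl 6 _⊕_
_⊕_ : ∀ {n} → Vertex n → Vertex n → Vertex n
[]      ⊕ []      = []
(a ∷ u) ⊕ (b ∷ v) = (a xor b) ∷ (u ⊕ v)

bit-⊕ : ∀ {n} (u v : Vertex n) k → bit (u ⊕ v) k ≡ bit u k xor bit v k
bit-⊕ []      []      k       = refl
bit-⊕ (a ∷ u) (b ∷ v) zero    = refl
bit-⊕ (a ∷ u) (b ∷ v) (suc k) = bit-⊕ u v k

⊕-comm : ∀ {n} (u v : Vertex n) → u ⊕ v ≡ v ⊕ u
⊕-comm []      []      = refl
⊕-comm (a ∷ u) (b ∷ v) = cong₂ _∷_ (xor-comm a b) (⊕-comm u v)

⊕-assoc : ∀ {n} (u v w : Vertex n) → u ⊕ v ⊕ w ≡ u ⊕ (v ⊕ w)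
⊕-assoc []      []      []      = refl
⊕-assoc (a ∷ u) (b ∷ v) (c ∷ w) = cong₂ _∷_ (xor-assoc a b c) (⊕-assoc u v w)

⊕-self : ∀ {n} (u : Vertex n) → u ⊕ u ≡ zeros
⊕-self []      = refl
⊕-self (a ∷ u) = cong₂ _∷_ (xor-same a) (⊕-self u)

⊕-identityʳ : ∀ {n} (u : Vertex n) → u ⊕ zeros ≡ u
⊕-identityʳ []      = refl
⊕-identityʳ (a ∷ u) = cong₂ _∷_ (xor-identityʳ a) (⊕-identityʳ u)

⊕-identityˡ : ∀ {n} (u : Vertex n) → zeros ⊕ u ≡ u
⊕-identityˡ u = trans (⊕-comm zeros u) (⊕-identityʳ u)

x⊕[x⊕y]≡y : ∀ {n} (x y : Vertex n) → x ⊕ (x ⊕ y) ≡ y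
x⊕[x⊕y]≡y x y = begin
  x ⊕ (x ⊕ y) ≡⟨ ⊕-assoc x x y ⟨
  x ⊕ x ⊕ y   ≡⟨ cong (_⊕ y) (⊕-self x) ⟩
  zeros ⊕ y   ≡⟨ ⊕-identityˡ y ⟩
  y           ∎
  where open ≡-Reasoning

x⊕y⊕y≡x : ∀ {n} (x y : Vertex n) → x ⊕ y ⊕ y ≡ x
x⊕y⊕y≡x x y = begin
  x ⊕ y ⊕ y   ≡⟨ ⊕-assoc x y y ⟩
  x ⊕ (y ⊕ y) ≡⟨ cong (x ⊕_) (⊕-self y) ⟩
  x ⊕ zeros   ≡⟨ ⊕-identityʳ x ⟩
  x           ∎
  where open ≡-Reasoning

[x⊕a]⊕[x⊕b]≡a⊕b : ∀ {n} (x a b : Vertex n) → (x ⊕ a) ⊕ (x ⊕ b) ≡ a ⊕ b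
[x⊕a]⊕[x⊕b]≡a⊕b x a b = begin
  (x ⊕ a) ⊕ (x ⊕ b) ≡⟨ ⊕-assoc x a (x ⊕ b) ⟩
  x ⊕ (a ⊕ (x ⊕ b)) ≡⟨ cong (x ⊕_) (⊕-assoc a x b) ⟨
  x ⊕ (a ⊕ x ⊕ b)   ≡⟨ cong (λ z → x ⊕ (z ⊕ b)) (⊕-comm a x) ⟩
  x ⊕ (x ⊕ a ⊕ b)   ≡⟨ cong (x ⊕_) (⊕-assoc x a b) ⟩
  x ⊕ (x ⊕ (a ⊕ b)) ≡⟨ x⊕[x⊕y]≡y x (a ⊕ b) ⟩
  a ⊕ b             ∎
  where open ≡-Reasoning

x⊕a⊕b≡x⊕b⊕a : ∀ {n} (x a b : Vertex n) → x ⊕ a ⊕ b ≡ x ⊕ b ⊕ a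
x⊕a⊕b≡x⊕b⊕a x a b =
  trans (⊕-assoc x a b) (trans (cong (x ⊕_) (⊕-comm a b)) (sym (⊕-assoc x b a)))

⊕-cancelˡ : ∀ {n} (x : Vertex n) {a b} → x ⊕ a ≡ x ⊕ b → a ≡ b
⊕-cancelˡ x {a} {b} e = trans (sym (x⊕[x⊕y]≡y x a)) (trans (cong (x ⊕_) e) (x⊕[x⊕y]≡y x b))

u⊕v≡w⇒w⊕v≡u : ∀ {n} {u v w : Vertex n} → u ⊕ v ≡ w → w ⊕ v ≡ u
u⊕v≡w⇒w⊕v≡u {u = u} {v} refl = x⊕y⊕y≡x u v

-- Vectors described by a shape

data Shape : Set where
  e c ē : ℕ → Shape

OneAt : Shape → ℕ → Set
OneAt (e a) p = a ≡ p
OneAt (c l) p = l ≤ p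
OneAt (ē a) p = a ≢ p

oneAt? : ∀ s p → Dec (OneAt s p)
oneAt? (e a) p = a ≟ p
oneAt? (c l) p = l ≤? p
oneAt? (ē a) p = ¬? (a ≟ p)

⟦_⟧ : ∀ {n} → Shape → Vertex n
⟦ s ⟧ = tabulateℕ (λ p → does (oneAt? s p))

bit-⟦⟧ : ∀ {n} s p → p < n → bit (⟦_⟧ {n} s) p ≡ does (oneAt? s p)
bit-⟦⟧ s = bit-tabulateℕ (λ p → does (oneAt? s p))

unit : ∀ {n} → ℕ → Vertex n
unit a = ⟦ e a ⟧

suffix : ∀ {n} → ℕ → Vertex n
suffix l = ⟦ c l ⟧

u⊕v≡w⇒u⊕w≡v : ∀ {n} {u v w : Vertex n} → u ⊕ v ≡ w → u ⊕ w ≡ v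
u⊕v≡w⇒u⊕w≡v {u = u} {v} refl = x⊕[x⊕y]≡y u v

⊕-unit-induction : ∀ {n} (P : Vertex n → Set) → P zeros →
                   (∀ {x} k → k < n → P x → P (x ⊕ unit k)) → ∀ v → P v
⊕-unit-induction {zero}  P P₀ step []      = P₀
⊕-unit-induction {suc n} P P₀ step (b ∷ v) = withHead b
  (⊕-unit-induction (λ w → P (false ∷ w)) P₀ (λ k k<n → step (suc k) (s≤s k<n)) v)
  where
  withHead : ∀ b → P (false ∷ v) → P (b ∷ v)
  withHead false p = p
  withHead true  p = subst (λ w → P (true ∷ w)) (⊕-identityʳ v) (step 0 (s≤s z≤n) p)

data XorPattern (A B C : Set) : Set where
  ttf : A → B → ¬ C → XorPattern A B C
  tft : A → ¬ B → C → XorPattern A B C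
  ftt : ¬ A → B → C → XorPattern A B C
  fff : ¬ A → ¬ B → ¬ C → XorPattern A B C

xorPattern : ∀ {A B C : Set} (x? : Dec A) (y? : Dec B) (z? : Dec C) →
             does x? xor does y? ≡ does z? → XorPattern A B C
xorPattern (yes x) (yes y) (no z)  _ = ttf x y z
xorPattern (yes x) (no y)  (yes z) _ = tft x y z
xorPattern (no x)  (yes y) (yes z) _ = ftt x y z
xorPattern (no x)  (no y)  (no z)  _ = fff x y z
xorPattern (yes _) (yes _) (yes _) ()
xorPattern (yes _) (no _)  (no _)  ()
xorPattern (no _)  (yes _) (no _)  ()
xorPattern (no _)  (no _)  (yes _) ()

xorPattern⇒xor : ∀ {A B C : Set} (x? : Dec A) (y? : Dec B) (z? : Dec C) →
                 XorPattern A B C → does x? xor does y? ≡ does z?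
xorPattern⇒xor x? y? z? (ttf x y ¬z)
  rewrite dec-true x? x | dec-true y? y | dec-false z? ¬z = refl
xorPattern⇒xor x? y? z? (tft x ¬y z)
  rewrite dec-true x? x | dec-false y? ¬y | dec-true z? z = refl
xorPattern⇒xor x? y? z? (ftt ¬x y z)
  rewrite dec-false x? ¬x | dec-true y? y | dec-true z? z = refl
xorPattern⇒xor x? y? z? (fff ¬x ¬y ¬z)
  rewrite dec-false x? ¬x | dec-false y? ¬y | dec-false z? ¬z = refl

⟦⟧≢⟦⟧ : ∀ {n} s t p → p < n → OneAt s p → ¬ OneAt t p → ⟦_⟧ {n} s ≢ ⟦ t ⟧
⟦⟧≢⟦⟧ {n} s t p p<n one ¬one eq = case bits of λ ()
  where
  bits : true ≡ false
  bits = begin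
    true              ≡⟨ dec-true (oneAt? s p) one ⟨
    does (oneAt? s p) ≡⟨ bit-⟦⟧ s p p<n ⟨
    bit (⟦_⟧ {n} s) p ≡⟨ cong (λ v → bit v p) eq ⟩
    bit (⟦_⟧ {n} t) p ≡⟨ bit-⟦⟧ t p p<n ⟩
    does (oneAt? t p) ≡⟨ dec-false (oneAt? t p) ¬one ⟩
    false             ∎
    where open ≡-Reasoning

zeros≢⟦⟧ : ∀ {n} s p → p < n → OneAt s p → zeros ≢ ⟦_⟧ {n} s
zeros≢⟦⟧ {n} s p p<n one eq = case bit-zeros of λ ()
  where
  bit-zeros : false ≡ true
  bit-zeros = begin
    false             ≡⟨ bit-tabulateℕ (λ _ → false) p p<n ⟨
    bit (zeros {n}) p ≡⟨ cong (λ v → bit v p) eq ⟩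
    bit (⟦_⟧ {n} s) p ≡⟨ bit-⟦⟧ s p p<n ⟩
    does (oneAt? s p) ≡⟨ dec-true (oneAt? s p) one ⟩
    true              ∎
    where open ≡-Reasoning

xorPattern-at : ∀ {n} s t r p → p < n → ⟦ s ⟧ ⊕ ⟦ t ⟧ ≡ ⟦_⟧ {n} r →
                XorPattern (OneAt s p) (OneAt t p) (OneAt r p)
xorPattern-at {n} s t r p p<n eq = xorPattern (oneAt? s p) (oneAt? t p) (oneAt? r p) (begin
  does (oneAt? s p) xor does (oneAt? t p) ≡⟨ cong₂ _xor_ (bit-⟦⟧ s p p<n) (bit-⟦⟧ t p p<n) ⟨
  bit u p xor bit v p                     ≡⟨ bit-⊕ u v p ⟨
  bit (u ⊕ v) p                           ≡⟨ cong (λ x → bit x p) eq ⟩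
  bit w p                                 ≡⟨ bit-⟦⟧ r p p<n ⟩
  does (oneAt? r p)                       ∎)
  where
  open ≡-Reasoning
  u v w : Vertex n
  u = ⟦ s ⟧
  v = ⟦ t ⟧
  w = ⟦ r ⟧

⊕-by-xorPatterns : ∀ {n} s t r → (∀ p → XorPattern (OneAt s p) (OneAt t p) (OneAt r p)) →
                   ⟦ s ⟧ ⊕ ⟦ t ⟧ ≡ ⟦_⟧ {n} r
⊕-by-xorPatterns {n} s t r bits = ≡-by-bits λ p p<n → begin
  bit (u ⊕ v) p                           ≡⟨ bit-⊕ u v p ⟩
  bit u p xor bit v p                     ≡⟨ cong₂ _xor_ (bit-⟦⟧ s p p<n) (bit-⟦⟧ t p p<n) ⟩
  does (oneAt? s p) xor does (oneAt? t p) ≡⟨ xorPattern⇒xor (oneAt? s p) (oneAt? t p) (oneAt? r p) (bits p) ⟩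
  does (oneAt? r p)                       ≡⟨ bit-⟦⟧ r p p<n ⟨
  bit w p                                 ∎
  where
  open ≡-Reasoning
  u v w : Vertex n
  u = ⟦ s ⟧
  v = ⟦ t ⟧
  w = ⟦ r ⟧

c[l]⊕c[1+l]≡e[l] : ∀ {n} l → ⟦ c l ⟧ ⊕ ⟦ c (suc l) ⟧ ≡ ⟦_⟧ {n} (e l)
c[l]⊕c[1+l]≡e[l] l = ⊕-by-xorPatterns (c l) (c (suc l)) (e l) bits
  where
  bits : ∀ p → XorPattern (l ≤ p) (suc l ≤ p) (l ≡ p)
  bits p with <-cmp l p
  ... | tri< l<p l≢p _ = ttf (<⇒≤ l<p) l<p l≢p
  ... | tri≈ _ refl _  = tft ≤-refl 1+n≰n refl
  ... | tri> _ l≢p p<l = fff (<⇒≱ p<l) (λ l<p → <⇒≱ p<l (<⇒≤ l<p)) l≢p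

c[l]⊕e[l]≡c[1+l] : ∀ {n} l → ⟦ c l ⟧ ⊕ ⟦ e l ⟧ ≡ ⟦_⟧ {n} (c (suc l))
c[l]⊕e[l]≡c[1+l] l = ⊕-by-xorPatterns (c l) (e l) (c (suc l)) bits
  where
  bits : ∀ p → XorPattern (l ≤ p) (l ≡ p) (suc l ≤ p)
  bits p with <-cmp l p
  ... | tri< l<p l≢p _ = tft (<⇒≤ l<p) l≢p l<p
  ... | tri≈ _ refl _  = ttf ≤-refl refl 1+n≰n
  ... | tri> _ l≢p p<l = fff (<⇒≱ p<l) l≢p (λ l<p → <⇒≱ p<l (<⇒≤ l<p))

c[0]⊕e[a]≡ē[a] : ∀ {n} a → ⟦ c 0 ⟧ ⊕ ⟦ e a ⟧ ≡ ⟦_⟧ {n} (ē a)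
c[0]⊕e[a]≡ē[a] a = ⊕-by-xorPatterns (c 0) (e a) (ē a) bits
  where
  bits : ∀ p → XorPattern (0 ≤ p) (a ≡ p) (a ≢ p)
  bits p with a ≟ p
  ... | yes a≡p = ttf z≤n a≡p (λ a≢p → a≢p a≡p)
  ... | no  a≢p = tft z≤n a≢p a≢p

suffix-last : ∀ {n} → suffix {suc n} n ≡ unit n
suffix-last {n} = ≡-by-bits λ k k<1+n → begin
  bit (suffix {suc n} n) k ≡⟨ bit-⟦⟧ (c n) k k<1+n ⟩
  does (n ≤? k)            ≡⟨ does-⇔ (mk⇔ (λ n≤k → ≤-antisym n≤k (≤-pred k<1+n)) ≤-reflexive) (n ≤? k) (n ≟ k) ⟩
  does (n ≟ k)             ≡⟨ bit-⟦⟧ (e n) k k<1+n ⟨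
  bit (unit {suc n} n) k   ∎
  where open ≡-Reasoning

-- AQ_n as a Cayley graph

DiffersExactlyWhere : ∀ {n} → Vertex n → Vertex n → (ℕ → Set) → Set
DiffersExactlyWhere {n} u v P =
  (i : Fin n) → (P (toℕ i) → lookup u i ≢ lookup v i) × (¬ P (toℕ i) → lookup u i ≡ lookup v i)

private
  xor≡does⇒ : ∀ {P : Set} a b (p? : Dec P) → a xor b ≡ does p? → (P → a ≢ b) × (¬ P → a ≡ b)
  xor≡does⇒ true  true  (no ¬p) _ = (λ p → ⊥-elim (¬p p)) , (λ _ → refl)
  xor≡does⇒ false false (no ¬p) _ = (λ p → ⊥-elim (¬p p)) , (λ _ → refl)
  xor≡does⇒ true  false (yes p) _ = (λ _ ()) , (λ ¬p → ⊥-elim (¬p p))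
  xor≡does⇒ false true  (yes p) _ = (λ _ ()) , (λ ¬p → ⊥-elim (¬p p))
  xor≡does⇒ true  true  (yes _) ()
  xor≡does⇒ false false (yes _) ()
  xor≡does⇒ true  false (no _)  ()
  xor≡does⇒ false true  (no _)  ()

  xor≡does⇐ : ∀ {P : Set} a b (p? : Dec P) → (P → a ≢ b) × (¬ P → a ≡ b) → a xor b ≡ does p?
  xor≡does⇐ true  true  (yes p) (differ , _) = ⊥-elim (differ p refl)
  xor≡does⇐ false false (yes p) (differ , _) = ⊥-elim (differ p refl)
  xor≡does⇐ true  false (yes _) _            = refl
  xor≡does⇐ false true  (yes _) _            = refl
  xor≡does⇐ true  true  (no _)  _            = refl
  xor≡does⇐ false false (no _)  _            = refl
  xor≡does⇐ true  false (no ¬p) (_ , agree)  = case agree ¬p of λ ()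
  xor≡does⇐ false true  (no ¬p) (_ , agree)  = case agree ¬p of λ ()

bit-⊕-lookup : ∀ {n} (u v : Vertex n) (i : Fin n) → bit (u ⊕ v) (toℕ i) ≡ lookup u i xor lookup v i
bit-⊕-lookup u v i = trans (bit-⊕ u v (toℕ i)) (sym (cong₂ _xor_ (lookup≡bit u i) (lookup≡bit v i)))

⊕≡⟦⟧⇒differs : ∀ {n} {u v : Vertex n} s → u ⊕ v ≡ ⟦ s ⟧ → DiffersExactlyWhere u v (OneAt s)
⊕≡⟦⟧⇒differs {u = u} {v} s eq i = xor≡does⇒ (lookup u i) (lookup v i) (oneAt? s (toℕ i))
  (trans (sym (bit-⊕-lookup u v i)) (trans (cong (λ x → bit x (toℕ i)) eq) (bit-⟦⟧ s (toℕ i) (toℕ<n i))))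

differs⇒⊕≡⟦⟧ : ∀ {n} {u v : Vertex n} s → DiffersExactlyWhere u v (OneAt s) → u ⊕ v ≡ ⟦ s ⟧
differs⇒⊕≡⟦⟧ {n} {u} {v} s d = ≡-by-bits λ k k<n → begin
  bit (u ⊕ v) k                               ≡⟨ cong (bit (u ⊕ v)) (toℕ-fromℕ< k<n) ⟨
  bit (u ⊕ v) (toℕ (fromℕ< k<n))              ≡⟨ bit-⊕-lookup u v (fromℕ< k<n) ⟩
  lookup u (fromℕ< k<n) xor lookup v (fromℕ< k<n)
    ≡⟨ xor≡does⇐ _ _ (oneAt? s (toℕ (fromℕ< k<n))) (d (fromℕ< k<n)) ⟩
  does (oneAt? s (toℕ (fromℕ< k<n)))          ≡⟨ cong (λ p → does (oneAt? s p)) (toℕ-fromℕ< k<n) ⟩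
  does (oneAt? s k)                           ≡⟨ bit-⟦⟧ s k k<n ⟨
  bit (⟦_⟧ {n} s) k                           ∎
  where open ≡-Reasoning

hypercubeAdj⇒⊕≡unit : ∀ {n} {u v : Vertex n} → HypercubeAdj u v → Σ ℕ λ a → a < n × u ⊕ v ≡ unit a
hypercubeAdj⇒⊕≡unit {u = u} {v} (i , u≢v , rest) = toℕ i , toℕ<n i , differs⇒⊕≡⟦⟧ (e (toℕ i)) λ j →
  (λ i≡j → subst (λ k → lookup u k ≢ lookup v k) (toℕ-injective i≡j) u≢v) ,
  (λ i≢j → rest j (λ j≡i → i≢j (cong toℕ (sym j≡i))))

⊕≡unit⇒hypercubeAdj : ∀ {n} {u v : Vertex n} {a} → a < n → u ⊕ v ≡ unit a → HypercubeAdj u v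
⊕≡unit⇒hypercubeAdj {a = a} a<n eq = fromℕ< a<n ,
  proj₁ (d (fromℕ< a<n)) (sym (toℕ-fromℕ< a<n)) ,
  λ j j≢i → proj₂ (d j) (λ a≡j → j≢i (toℕ-injective (trans (sym a≡j) (sym (toℕ-fromℕ< a<n)))))
  where d = ⊕≡⟦⟧⇒differs (e a) eq

complementAdj⇒⊕≡suffix : ∀ {n} {u v : Vertex n} → ComplementAdj u v →
                         Σ ℕ λ l → l + 2 ≤ n × u ⊕ v ≡ suffix l
complementAdj⇒⊕≡suffix (l , l+2≤n , f) = l , l+2≤n , differs⇒⊕≡⟦⟧ (c l) λ i →
  proj₂ (f i) , (λ l≰i → proj₁ (f i) (≰⇒> l≰i))

⊕≡suffix⇒complementAdj : ∀ {n} {u v : Vertex n} {l} → l + 2 ≤ n → u ⊕ v ≡ suffix l → ComplementAdj u v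
⊕≡suffix⇒complementAdj {l = l} l+2≤n eq = l , l+2≤n , λ i →
  (λ i<l → proj₂ (d i) (<⇒≱ i<l)) , proj₁ (d i)
  where d = ⊕≡⟦⟧⇒differs (c l) eq

module AQ (m : ℕ) where

  N : ℕ
  N = suc (suc m)

  data IsGenerator (g : Vertex N) : Set where
    is-unit   : ∀ {a} → a < N → g ≡ unit a → IsGenerator g
    is-suffix : ∀ {l} → l ≤ m → g ≡ suffix l → IsGenerator g

  Adjacent : Vertex N → Vertex N → Set
  Adjacent u v = IsGenerator (u ⊕ v)

  aqAdj⇒adjacent : ∀ {u v} → AQAdj u v → Adjacent u v
  aqAdj⇒adjacent (inj₁ h) = let a , a<N , eq = hypercubeAdj⇒⊕≡unit h in is-unit a<N eq
  aqAdj⇒adjacent (inj₂ h) = let l , l+2≤N , eq = complementAdj⇒⊕≡suffix h in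
    is-suffix (≤-pred (≤-pred (subst (_≤ N) (+-comm l 2) l+2≤N))) eq

  adjacent⇒aqAdj : ∀ {u v} → Adjacent u v → AQAdj u v
  adjacent⇒aqAdj (is-unit a<N eq)        = inj₁ (⊕≡unit⇒hypercubeAdj a<N eq)
  adjacent⇒aqAdj (is-suffix {l} l≤m eq) =
    inj₂ (⊕≡suffix⇒complementAdj (subst (_≤ N) (+-comm 2 l) (s≤s (s≤s l≤m))) eq)

  adjacent-sym : ∀ {u v} → Adjacent u v → Adjacent v u
  adjacent-sym {u} {v} = subst IsGenerator (⊕-comm u v)

  adjacent-⊕ : ∀ x {g} → IsGenerator g → Adjacent x (x ⊕ g)
  adjacent-⊕ x {g} = subst IsGenerator (sym (x⊕[x⊕y]≡y x g))

  adjacent-⊕⁻¹ : ∀ x {g} → Adjacent x (x ⊕ g) → IsGenerator g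
  adjacent-⊕⁻¹ x {g} = subst IsGenerator (x⊕[x⊕y]≡y x g)

  ⊕-preserves-adjacent : ∀ x {a b} → Adjacent a b → Adjacent (x ⊕ a) (x ⊕ b)
  ⊕-preserves-adjacent x {a} {b} = subst IsGenerator (sym ([x⊕a]⊕[x⊕b]≡a⊕b x a b))

  ⊕-reflects-adjacent : ∀ x {a b} → Adjacent (x ⊕ a) (x ⊕ b) → Adjacent a b
  ⊕-reflects-adjacent x {a} {b} = subst IsGenerator ([x⊕a]⊕[x⊕b]≡a⊕b x a b)

  ≤m⇒<N : ∀ {i} → i ≤ m → i < N
  ≤m⇒<N i≤m = s≤s (m≤n⇒m≤1+n i≤m)

  isGenerator-unit : ∀ {a} → a < N → IsGenerator (unit a)
  isGenerator-unit a<N = is-unit a<N refl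

  isGenerator-suffix : ∀ {l} → l ≤ suc m → IsGenerator (suffix l)
  isGenerator-suffix l≤1+m with m≤n⇒m<n∨m≡n l≤1+m
  ... | inj₁ (s≤s l≤m) = is-suffix l≤m refl
  ... | inj₂ refl      = is-unit ≤-refl suffix-last

  ¬isGenerator-zeros : ¬ IsGenerator zeros
  ¬isGenerator-zeros (is-unit {a} a<N eq)   = zeros≢⟦⟧ (e a) a a<N refl eq
  ¬isGenerator-zeros (is-suffix {l} l≤m eq) = zeros≢⟦⟧ (c l) (suc m) ≤-refl (m≤n⇒m≤1+n l≤m) eq

  e[1+m]⊕c[i]≡e[b] : ∀ {i b} → i ≤ m → unit (suc m) ⊕ suffix i ≡ unit b → i ≡ m × b ≡ m
  e[1+m]⊕c[i]≡e[b] {i} {b} i≤m eq with xorPattern-at (e (suc m)) (c i) (e b) m (≤m⇒<N ≤-refl) eq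
  ... | ttf 1+m≡m _ _ = ⊥-elim (1+n≢n 1+m≡m)
  ... | tft _ i≰m _   = ⊥-elim (i≰m i≤m)
  ... | fff _ i≰m _   = ⊥-elim (i≰m i≤m)
  ... | ftt _ _ b≡m with xorPattern-at (e (suc m)) (c i) (e b) i (≤m⇒<N i≤m) eq
  ...   | ftt _ _ b≡i   = trans (sym b≡i) b≡m , b≡m
  ...   | ttf 1+m≡i _ _ = ⊥-elim (1+n≰n (subst (_≤ m) (sym 1+m≡i) i≤m))
  ...   | tft _ i≰i _   = ⊥-elim (i≰i ≤-refl)
  ...   | fff _ i≰i _   = ⊥-elim (i≰i ≤-refl)

  e[a]⊕c[i]≡e[b] : ∀ {a i b} → i ≤ m → unit a ⊕ suffix i ≡ unit b →
                   i ≡ m × (a ≡ m × b ≡ suc m ⊎ a ≡ suc m × b ≡ m)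
  e[a]⊕c[i]≡e[b] {a} {i} {b} i≤m eq with xorPattern-at (e a) (c i) (e b) (suc m) ≤-refl eq
  ... | ttf refl _ _  = let i≡m , b≡m = e[1+m]⊕c[i]≡e[b] i≤m eq in i≡m , inj₂ (refl , b≡m)
  ... | ftt _ _ refl  = let i≡m , a≡m = e[1+m]⊕c[i]≡e[b] i≤m (u⊕v≡w⇒w⊕v≡u {u = unit a} {suffix i} eq)
                        in i≡m , inj₁ (a≡m , refl)
  ... | tft _ i≰1+m _ = ⊥-elim (i≰1+m (m≤n⇒m≤1+n i≤m))
  ... | fff _ i≰1+m _ = ⊥-elim (i≰1+m (m≤n⇒m≤1+n i≤m))

  e[a]⊕c[i]≡c[k]-< : ∀ {a i k} → i < k → k ≤ m → unit a ⊕ suffix i ≡ suffix k → a ≡ i × k ≡ suc i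
  e[a]⊕c[i]≡c[k]-< {a} {i} {k} i<k k≤m eq
    with xorPattern-at (e a) (c i) (c k) i (≤m⇒<N (≤-trans (<⇒≤ i<k) k≤m)) eq
  ... | tft _ i≰i _ = ⊥-elim (i≰i ≤-refl)
  ... | fff _ i≰i _ = ⊥-elim (i≰i ≤-refl)
  ... | ftt _ _ k≤i = ⊥-elim (<⇒≱ i<k k≤i)
  ... | ttf a≡i _ _ with xorPattern-at (e a) (c i) (c k) (suc i) (≤m⇒<N (≤-trans i<k k≤m)) eq
  ...   | ttf a≡1+i _ _ = ⊥-elim (1+n≢n (trans (sym a≡1+i) a≡i))
  ...   | tft a≡1+i _ _ = ⊥-elim (1+n≢n (trans (sym a≡1+i) a≡i))
  ...   | fff _ i≰1+i _ = ⊥-elim (i≰1+i (n≤1+n i))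
  ...   | ftt _ _ k≤1+i = a≡i , ≤-antisym k≤1+i i<k

  e[a]⊕c[i]≡c[k] : ∀ {a i k} → a < N → i ≤ m → k ≤ m → unit a ⊕ suffix i ≡ suffix k →
                   a ≡ i × k ≡ suc i ⊎ suc a ≡ i × k ≡ a
  e[a]⊕c[i]≡c[k] {a} {i} {k} a<N i≤m k≤m eq with <-cmp i k
  ... | tri< i<k _ _ = inj₁ (e[a]⊕c[i]≡c[k]-< i<k k≤m eq)
  ... | tri> _ _ k<i = let a≡k , i≡1+k = e[a]⊕c[i]≡c[k]-< {a} k<i i≤m (u⊕v≡w⇒u⊕w≡v {u = unit a} {suffix i} eq)
                       in inj₂ (trans (cong suc a≡k) (sym i≡1+k) , sym a≡k)
  ... | tri≈ _ refl _ = ⊥-elim (zeros≢⟦⟧ (e a) a a<N refl (sym unit≡zeros))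
    where
    unit≡zeros : unit a ≡ zeros
    unit≡zeros = ⊕-cancelˡ (suffix i) (trans (⊕-comm (suffix i) (unit a))
                   (trans eq (sym (⊕-identityʳ (suffix i)))))

  c[j]⊕c[i]≢c[k] : ∀ {j i k} → j ≤ m → i ≤ m → k ≤ m → suffix j ⊕ suffix i ≢ suffix k
  c[j]⊕c[i]≢c[k] {j} {i} {k} j≤m i≤m k≤m eq with xorPattern-at (c j) (c i) (c k) (suc m) ≤-refl eq
  ... | ttf _ _ k≰1+m = k≰1+m (m≤n⇒m≤1+n k≤m)
  ... | tft _ i≰1+m _ = i≰1+m (m≤n⇒m≤1+n i≤m)
  ... | ftt j≰1+m _ _ = j≰1+m (m≤n⇒m≤1+n j≤m)
  ... | fff j≰1+m _ _ = j≰1+m (m≤n⇒m≤1+n j≤m)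

  e[a]⊕e[i]≢e[b] : ∀ {a i b} → a < N → i < N → b < N → unit a ⊕ unit i ≢ unit b
  e[a]⊕e[i]≢e[b] {a} {i} {b} a<N i<N b<N eq with xorPattern-at (e a) (e i) (e b) a a<N eq
  ... | ttf _ refl _ = zeros≢⟦⟧ (e b) b b<N refl (trans (sym (⊕-self (unit a))) eq)
  ... | tft _ _ refl = zeros≢⟦⟧ (e i) i i<N refl
                         (sym (⊕-cancelˡ (unit a) (trans eq (sym (⊕-identityʳ (unit a))))))
  ... | ftt a≢a _ _  = a≢a refl
  ... | fff a≢a _ _  = a≢a refl

  ¬isGenerator-c[i]⊕c[2+i] : ∀ {i} → suc i ≤ m → ¬ IsGenerator (suffix i ⊕ suffix (suc (suc i)))
  ¬isGenerator-c[i]⊕c[2+i] {i} 1+i≤m (is-unit {b} _ eq)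
    with xorPattern-at (c i) (c (suc (suc i))) (e b) i (≤m⇒<N (≤-trans (n≤1+n i) 1+i≤m)) eq
       | xorPattern-at (c i) (c (suc (suc i))) (e b) (suc i) (≤m⇒<N 1+i≤m) eq
  ... | tft _ _ b≡i | tft _ _ b≡1+i = 1+n≢n (trans (sym b≡1+i) b≡i)
  ... | ttf _ 2+i≤i _ | _ = 1+n≰n (≤-trans (n≤1+n (suc i)) 2+i≤i)
  ... | ftt i≰i _ _ | _   = i≰i ≤-refl
  ... | fff i≰i _ _ | _   = i≰i ≤-refl
  ... | tft _ _ _ | ttf _ 2+i≤1+i _ = 1+n≰n 2+i≤1+i
  ... | tft _ _ _ | ftt i≰1+i _ _   = i≰1+i (n≤1+n i)
  ... | tft _ _ _ | fff i≰1+i _ _   = i≰1+i (n≤1+n i)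
  ¬isGenerator-c[i]⊕c[2+i] {i} 1+i≤m (is-suffix {l} l≤m eq)
    with xorPattern-at (c i) (c (suc (suc i))) (c l) (suc m) ≤-refl eq
  ... | ttf _ _ l≰1+m = l≰1+m (m≤n⇒m≤1+n l≤m)
  ... | tft _ 2+i≰1+m _ = 2+i≰1+m (s≤s 1+i≤m)
  ... | ftt i≰1+m _ _ = i≰1+m (≤-trans (n≤1+n i) (m≤n⇒m≤1+n 1+i≤m))
  ... | fff i≰1+m _ _ = i≰1+m (≤-trans (n≤1+n i) (m≤n⇒m≤1+n 1+i≤m))

  ¬isGenerator-e[j]⊕c[2+j] : ∀ {j} → suc j ≤ m → ¬ IsGenerator (unit j ⊕ suffix (suc (suc j)))
  ¬isGenerator-e[j]⊕c[2+j] {j} 1+j≤m (is-unit {b} _ eq)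
    with xorPattern-at (e j) (c (suc (suc j))) (e b) j (≤m⇒<N (≤-trans (n≤1+n j) 1+j≤m)) eq
       | xorPattern-at (e j) (c (suc (suc j))) (e b) (suc (suc j)) (s≤s (s≤s 1+j≤m)) eq
  ... | tft _ _ b≡j | ftt _ _ b≡2+j = m+1+n≢n 1 (trans (sym b≡2+j) b≡j)
  ... | ttf _ 2+j≤j _ | _ = 1+n≰n (≤-trans (n≤1+n (suc j)) 2+j≤j)
  ... | ftt j≢j _ _ | _   = j≢j refl
  ... | fff j≢j _ _ | _   = j≢j refl
  ... | tft _ _ _ | ttf j≡2+j _ _   = m+1+n≢n 1 (sym j≡2+j)
  ... | tft _ _ _ | tft j≡2+j _ _   = m+1+n≢n 1 (sym j≡2+j)
  ... | tft _ _ _ | fff _ 2+j≰2+j _ = 2+j≰2+j ≤-refl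
  ¬isGenerator-e[j]⊕c[2+j] {j} 1+j≤m (is-suffix {l} _ eq)
    with xorPattern-at (e j) (c (suc (suc j))) (c l) j (≤m⇒<N (≤-trans (n≤1+n j) 1+j≤m)) eq
       | xorPattern-at (e j) (c (suc (suc j))) (c l) (suc j) (≤m⇒<N 1+j≤m) eq
  ... | tft _ _ l≤j | fff _ _ l≰1+j = l≰1+j (≤-trans l≤j (n≤1+n j))
  ... | ttf _ 2+j≤j _ | _ = 1+n≰n (≤-trans (n≤1+n (suc j)) 2+j≤j)
  ... | ftt j≢j _ _ | _   = j≢j refl
  ... | fff j≢j _ _ | _   = j≢j refl
  ... | tft _ _ _ | ttf j≡1+j _ _   = 1+n≢n (sym j≡1+j)
  ... | tft _ _ _ | tft j≡1+j _ _   = 1+n≢n (sym j≡1+j)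
  ... | tft _ _ _ | ftt _ 2+j≤1+j _ = 1+n≰n 2+j≤1+j

  suffixes-two-apart : ∀ x {j} → suc j ≤ m →
    ¬ Adjacent (x ⊕ suffix j) (x ⊕ suffix (suc (suc j))) × x ⊕ suffix (suc (suc j)) ≢ x ⊕ suffix j
  suffixes-two-apart x {j} 1+j≤m =
    (λ h → ¬isGenerator-c[i]⊕c[2+i] 1+j≤m (⊕-reflects-adjacent x h)) ,
    (λ eq → ⟦⟧≢⟦⟧ (c j) (c (suc (suc j))) j (≤m⇒<N (≤-trans (n≤1+n j) 1+j≤m)) ≤-refl
              (λ 2+j≤j → 1+n≰n (≤-trans (n≤1+n (suc j)) 2+j≤j)) (sym (⊕-cancelˡ x eq)))

  commonNeighbours-suffix : ∀ {g i} → i ≤ m → IsGenerator g → IsGenerator (g ⊕ suffix i) →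
    g ≡ unit i ⊎ g ≡ suffix (suc i) ⊎ Σ ℕ λ j → i ≡ suc j × (g ≡ unit j ⊎ g ≡ suffix j)
  commonNeighbours-suffix {i = i} i≤m (is-unit {a} _ refl) (is-unit {b} _ eq)
    with e[a]⊕c[i]≡e[b] {a} {i} {b} i≤m eq
  ... | refl , inj₁ (refl , _) = inj₁ refl
  ... | refl , inj₂ (refl , _) = inj₂ (inj₁ (sym suffix-last))
  commonNeighbours-suffix {i = i} i≤m (is-unit {a} a<N refl) (is-suffix k≤m eq)
    with e[a]⊕c[i]≡c[k] a<N i≤m k≤m eq
  ... | inj₁ (refl , _) = inj₁ refl
  ... | inj₂ (refl , _) = inj₂ (inj₂ (a , refl , inj₁ refl))
  commonNeighbours-suffix {i = i} i≤m (is-suffix {j} j≤m refl) (is-unit {b} b<N eq)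
    with e[a]⊕c[i]≡c[k] b<N i≤m j≤m (u⊕v≡w⇒w⊕v≡u {u = suffix j} {suffix i} eq)
  ... | inj₁ (_ , refl)    = inj₂ (inj₁ refl)
  ... | inj₂ (refl , refl) = inj₂ (inj₂ (b , refl , inj₂ refl))
  commonNeighbours-suffix i≤m (is-suffix j≤m refl) (is-suffix k≤m eq) =
    ⊥-elim (c[j]⊕c[i]≢c[k] j≤m i≤m k≤m eq)

  commonNeighbours-unit : ∀ {g i} → i ≤ m → IsGenerator g → IsGenerator (g ⊕ unit i) →
                          g ≡ suffix i ⊎ g ≡ suffix (suc i)
  commonNeighbours-unit i≤m (is-unit a<N refl) (is-unit b<N eq) =
    ⊥-elim (e[a]⊕e[i]≢e[b] a<N (≤m⇒<N i≤m) b<N eq)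
  commonNeighbours-unit {i = i} i≤m (is-unit {a} _ refl) (is-suffix {k} k≤m eq)
    with e[a]⊕c[i]≡e[b] {i} {k} {a} k≤m
           (trans (⊕-comm (unit i) (suffix k)) (u⊕v≡w⇒w⊕v≡u {u = unit a} {unit i} eq))
  ... | _ , inj₁ (refl , refl) = inj₂ (sym suffix-last)
  ... | _ , inj₂ (refl , _)    = ⊥-elim (1+n≰n i≤m)
  commonNeighbours-unit {i = i} i≤m (is-suffix {j} j≤m refl) (is-unit {b} _ eq)
    with e[a]⊕c[i]≡e[b] {i} {j} {b} j≤m (trans (⊕-comm (unit i) (suffix j)) eq)
  ... | refl , inj₁ (refl , _) = inj₁ refl
  ... | _ , inj₂ (refl , _)    = ⊥-elim (1+n≰n i≤m)
  commonNeighbours-unit {i = i} i≤m (is-suffix {j} j≤m refl) (is-suffix k≤m eq)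
    with e[a]⊕c[i]≡c[k] (≤m⇒<N i≤m) j≤m k≤m (trans (⊕-comm (unit i) (suffix j)) eq)
  ... | inj₁ (refl , _) = inj₁ refl
  ... | inj₂ (refl , _) = inj₂ refl

  commonNeighbours-ē : 2 ≤ m → ∀ {g} → IsGenerator g → IsGenerator (g ⊕ ⟦ ē (suc m) ⟧) →
                       g ≡ suffix 0 ⊎ g ≡ unit (suc m)
  commonNeighbours-ē 2≤m (is-unit {a} _ refl) h with a ≟ suc m
  ... | yes refl = inj₂ refl
  commonNeighbours-ē 2≤m (is-unit {a} _ refl) (is-unit {b} _ eq) | no _ =
    ⊥-elim (pigeonhole (low 0 z≤n) (low 1 (≤-trans (s≤s z≤n) 2≤m)) (low 2 2≤m))
    where
    -- This is where 2 ≤ m is needed: ⟦ ē (suc m) ⟧ has too many ones to be a sum of two unit vectors.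
    low : ∀ p → p ≤ m → a ≡ p ⊎ b ≡ p
    low p p≤m with xorPattern-at (e a) (ē (suc m)) (e b) p (≤m⇒<N p≤m) eq
    ... | ttf a≡p _ _    = inj₁ a≡p
    ... | ftt _ _ b≡p    = inj₂ b≡p
    ... | tft _ ¬1+m≢p _ = ⊥-elim (¬1+m≢p (λ 1+m≡p → 1+n≰n (subst (_≤ m) (sym 1+m≡p) p≤m)))
    ... | fff _ ¬1+m≢p _ = ⊥-elim (¬1+m≢p (λ 1+m≡p → 1+n≰n (subst (_≤ m) (sym 1+m≡p) p≤m)))
    pigeonhole : a ≡ 0 ⊎ b ≡ 0 → a ≡ 1 ⊎ b ≡ 1 → a ≡ 2 ⊎ b ≡ 2 → ⊥
    pigeonhole (inj₁ refl) (inj₁ ())       _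
    pigeonhole (inj₁ refl) (inj₂ refl) (inj₁ ())
    pigeonhole (inj₁ refl) (inj₂ refl) (inj₂ ())
    pigeonhole (inj₂ refl) (inj₁ refl) (inj₁ ())
    pigeonhole (inj₂ refl) (inj₁ refl) (inj₂ ())
    pigeonhole (inj₂ refl) (inj₂ ())       _
  commonNeighbours-ē 2≤m (is-unit {a} _ refl) (is-suffix {k} k≤m eq) | no a≢1+m
    with xorPattern-at (e a) (ē (suc m)) (c k) (suc m) ≤-refl eq
  ... | ttf _ 1+m≢1+m _ = ⊥-elim (1+m≢1+m refl)
  ... | ftt _ 1+m≢1+m _ = ⊥-elim (1+m≢1+m refl)
  ... | tft a≡1+m _ _   = ⊥-elim (a≢1+m a≡1+m)
  ... | fff _ _ k≰1+m   = ⊥-elim (k≰1+m (m≤n⇒m≤1+n k≤m))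
  commonNeighbours-ē 2≤m (is-suffix {j} j≤m refl) h with j ≟ 0
  ... | yes refl = inj₁ refl
  commonNeighbours-ē 2≤m (is-suffix {j} j≤m refl) (is-unit {b} _ eq) | no j≢0
    with xorPattern-at (c j) (ē (suc m)) (e b) 0 (s≤s z≤n) eq
       | xorPattern-at (c j) (ē (suc m)) (e b) (suc m) ≤-refl eq
  ... | ftt _ _ b≡0 | tft _ _ b≡1+m = ⊥-elim (1+n≢0 (trans (sym b≡1+m) b≡0))
  ... | ttf j≤0 _ _    | _ = ⊥-elim (j≢0 (n≤0⇒n≡0 j≤0))
  ... | tft j≤0 _ _    | _ = ⊥-elim (j≢0 (n≤0⇒n≡0 j≤0))
  ... | fff _ ¬1+m≢0 _ | _ = ⊥-elim (¬1+m≢0 1+n≢0)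
  ... | ftt _ _ _ | ttf _ 1+m≢1+m _ = ⊥-elim (1+m≢1+m refl)
  ... | ftt _ _ _ | ftt _ 1+m≢1+m _ = ⊥-elim (1+m≢1+m refl)
  ... | ftt _ _ _ | fff j≰1+m _ _   = ⊥-elim (j≰1+m (m≤n⇒m≤1+n j≤m))
  commonNeighbours-ē 2≤m (is-suffix {j} j≤m refl) (is-suffix {k} k≤m eq) | no _
    with xorPattern-at (c j) (ē (suc m)) (c k) m (≤m⇒<N ≤-refl) eq
  ... | ttf _ _ k≰m    = ⊥-elim (k≰m k≤m)
  ... | ftt j≰m _ _    = ⊥-elim (j≰m j≤m)
  ... | tft _ ¬1+m≢m _ = ⊥-elim (¬1+m≢m 1+n≢n)
  ... | fff _ ¬1+m≢m _ = ⊥-elim (¬1+m≢m 1+n≢n)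

-- Automorphisms fixing 0, c₀ and e_{n−1}

module Rigidity (m : ℕ) (2≤m : 2 ≤ m) (φ : Automorphism (suc (suc m))) where

  open AQ m
  open Automorphism φ
  open Inverse perm using (to)

  Fixed : Vertex N → Set
  Fixed v = to v ≡ v

  to-injective : ∀ {u v} → to u ≡ to v → u ≡ v
  to-injective = Injection.injective (↔⇒↣ perm)

  to-preserves : ∀ {u v} → Adjacent u v → Adjacent (to u) (to v)
  to-preserves h = aqAdj⇒adjacent (preserve _ _ (adjacent⇒aqAdj h))

  to-reflects : ∀ {u v} → Adjacent (to u) (to v) → Adjacent u v
  to-reflects h = aqAdj⇒adjacent (reflect _ _ (adjacent⇒aqAdj h))

  fixed⇒adjacent : ∀ {a y} → Fixed a → Adjacent a y → Adjacent a (to y)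
  fixed⇒adjacent {a} {y} fa h = subst (λ z → Adjacent z (to y)) fa (to-preserves h)

  fixed⇒nonadjacent : ∀ {a y} → Fixed a → ¬ Adjacent a y → ¬ Adjacent a (to y)
  fixed⇒nonadjacent {a} {y} fa ¬h h = ¬h (to-reflects (subst (λ z → Adjacent z (to y)) (sym fa) h))

  fixed⇒distinct : ∀ {a y} → Fixed a → y ≢ a → to y ≢ a
  fixed⇒distinct fa y≢a to-y≡a = y≢a (to-injective (trans to-y≡a (sym fa)))

  fixed-if-unique : ∀ x t (P : Vertex N → Set) → (∀ {y} → P y → P (to y)) →
                    (∀ g → P (x ⊕ g) → g ≡ t) → P (x ⊕ t) → Fixed (x ⊕ t)
  fixed-if-unique x t P preserved unique holds = begin
    to (x ⊕ t)             ≡⟨ x⊕[x⊕y]≡y x (to (x ⊕ t)) ⟨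
    x ⊕ (x ⊕ to (x ⊕ t))   ≡⟨ cong (x ⊕_) (unique (x ⊕ to (x ⊕ t)) P-image) ⟩
    x ⊕ t                  ∎
    where
    open ≡-Reasoning
    P-image : P (x ⊕ (x ⊕ to (x ⊕ t)))
    P-image = subst P (sym (x⊕[x⊕y]≡y x (to (x ⊕ t)))) (preserved holds)

  fixed-next-suffix : ∀ x i → suc i ≤ m → Fixed x → Fixed (x ⊕ suffix i) →
                      (∀ j → i ≡ suc j → Fixed (x ⊕ suffix j)) → Fixed (x ⊕ suffix (suc i))
  fixed-next-suffix x i 1+i≤m fx fi fprev = fixed-if-unique x (suffix (suc i)) Char preserved unique holds
    where
    -- The common neighbours of x and x ⊕ c_i are x ⊕ e_i, x ⊕ c_{i+1} and, when i = 1 + j, x ⊕ e_j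
    -- and x ⊕ c_j.  Only x ⊕ c_{i+1} keeps away from x ⊕ c_j and has a neighbour (x ⊕ c_{i+2}) that
    -- is adjacent to x but neither equal nor adjacent to x ⊕ c_i.
    i≤m : i ≤ m
    i≤m = ≤-trans (n≤1+n i) 1+i≤m
    AwayFromPrevious : Vertex N → Set
    AwayFromPrevious y = ∀ j → i ≡ suc j → ¬ Adjacent (x ⊕ suffix j) y × y ≢ x ⊕ suffix j
    HasFarNeighbour : Vertex N → Set
    HasFarNeighbour y =
      Σ (Vertex N) λ w → Adjacent x w × Adjacent w y × ¬ Adjacent (x ⊕ suffix i) w × w ≢ x ⊕ suffix i
    Char : Vertex N → Set
    Char y = Adjacent x y × Adjacent (x ⊕ suffix i) y × AwayFromPrevious y × HasFarNeighbour y
    preserved : ∀ {y} → Char y → Char (to y)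
    preserved (x~y , xci~y , away , w , x~w , w~y , xci≁w , w≢xci) =
      fixed⇒adjacent fx x~y , fixed⇒adjacent fi xci~y ,
      (λ j i≡1+j → fixed⇒nonadjacent (fprev j i≡1+j) (proj₁ (away j i≡1+j)) ,
                   fixed⇒distinct (fprev j i≡1+j) (proj₂ (away j i≡1+j))) ,
      to w , fixed⇒adjacent fx x~w , to-preserves w~y , fixed⇒nonadjacent fi xci≁w , fixed⇒distinct fi w≢xci
    xci~x⊕c[1+i] : Adjacent (x ⊕ suffix i) (x ⊕ suffix (suc i))
    xci~x⊕c[1+i] = ⊕-preserves-adjacent x
      (subst IsGenerator (sym (c[l]⊕c[1+l]≡e[l] i)) (isGenerator-unit (≤m⇒<N i≤m)))
    unique : ∀ g → Char (x ⊕ g) → g ≡ suffix (suc i)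
    unique g (x~y , xci~y , away , w , x~w , w~y , xci≁w , w≢xci)
      with commonNeighbours-suffix i≤m (adjacent-⊕⁻¹ x x~y) (adjacent-sym (⊕-reflects-adjacent x xci~y))
    ... | inj₂ (inj₁ g≡c[1+i])                = g≡c[1+i]
    ... | inj₂ (inj₂ (j , i≡1+j , inj₂ refl)) = ⊥-elim (proj₂ (away j i≡1+j) refl)
    ... | inj₂ (inj₂ (j , i≡1+j , inj₁ refl)) = ⊥-elim (proj₁ (away j i≡1+j) (⊕-preserves-adjacent x
          (subst IsGenerator (sym (c[l]⊕e[l]≡c[1+l] j))
            (isGenerator-suffix (subst (_≤ suc m) i≡1+j (m≤n⇒m≤1+n i≤m))))))
    ... | inj₁ refl with commonNeighbours-unit i≤m x~w
                           (⊕-reflects-adjacent x (subst (λ z → Adjacent z (x ⊕ unit i)) (sym (x⊕[x⊕y]≡y x w)) w~y))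
    ...   | inj₁ x⊕w≡ci     = ⊥-elim (w≢xci (trans (sym (x⊕[x⊕y]≡y x w)) (cong (x ⊕_) x⊕w≡ci)))
    ...   | inj₂ x⊕w≡c[1+i] = ⊥-elim (xci≁w (subst (Adjacent (x ⊕ suffix i))
              (trans (cong (x ⊕_) (sym x⊕w≡c[1+i])) (x⊕[x⊕y]≡y x w)) xci~x⊕c[1+i]))
    holds : Char (x ⊕ suffix (suc i))
    holds =
      adjacent-⊕ x (isGenerator-suffix (m≤n⇒m≤1+n 1+i≤m)) , xci~x⊕c[1+i] ,
      (λ j i≡1+j → subst (λ k → ¬ Adjacent (x ⊕ suffix j) (x ⊕ suffix (suc k)) × x ⊕ suffix (suc k) ≢ x ⊕ suffix j)
                         (sym i≡1+j) (suffixes-two-apart x (subst (_≤ m) i≡1+j i≤m))) ,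
      x ⊕ suffix (suc (suc i)) ,
      adjacent-⊕ x (isGenerator-suffix (s≤s 1+i≤m)) ,
      ⊕-preserves-adjacent x (adjacent-sym {suffix (suc i)}
        (subst IsGenerator (sym (c[l]⊕c[1+l]≡e[l] (suc i))) (isGenerator-unit (≤m⇒<N 1+i≤m)))) ,
      suffixes-two-apart x 1+i≤m

  fixed-unit : ∀ x i → i ≤ m → Fixed x → Fixed (x ⊕ suffix i) → Fixed (x ⊕ suffix (suc i)) →
               Fixed (x ⊕ unit i)
  fixed-unit x i i≤m fx fi f1+i = fixed-if-unique x (unit i) Char preserved unique holds
    where
    Char : Vertex N → Set
    Char y = Adjacent x y × Adjacent (x ⊕ suffix i) y × Adjacent (x ⊕ suffix (suc i)) y
    preserved : ∀ {y} → Char y → Char (to y)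
    preserved (x~y , xci~y , xc[1+i]~y) =
      fixed⇒adjacent fx x~y , fixed⇒adjacent fi xci~y , fixed⇒adjacent f1+i xc[1+i]~y
    unique : ∀ g → Char (x ⊕ g) → g ≡ unit i
    unique g (x~y , xci~y , xc[1+i]~y)
      with commonNeighbours-suffix i≤m (adjacent-⊕⁻¹ x x~y) (adjacent-sym (⊕-reflects-adjacent x xci~y))
    ... | inj₁ g≡ei = g≡ei
    ... | inj₂ (inj₁ refl) =
      ⊥-elim (¬isGenerator-zeros (subst IsGenerator (⊕-self (suffix (suc i))) (⊕-reflects-adjacent x xc[1+i]~y)))
    ... | inj₂ (inj₂ (j , i≡1+j , inj₁ refl)) =
      ⊥-elim (¬isGenerator-e[j]⊕c[2+j] (subst (_≤ m) i≡1+j i≤m)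
        (subst (λ k → IsGenerator (unit j ⊕ suffix (suc k))) i≡1+j
          (adjacent-sym {suffix (suc i)} (⊕-reflects-adjacent x xc[1+i]~y))))
    ... | inj₂ (inj₂ (j , i≡1+j , inj₂ refl)) =
      ⊥-elim (¬isGenerator-c[i]⊕c[2+i] (subst (_≤ m) i≡1+j i≤m)
        (subst (λ k → IsGenerator (suffix j ⊕ suffix (suc k))) i≡1+j
          (adjacent-sym {suffix (suc i)} (⊕-reflects-adjacent x xc[1+i]~y))))
    holds : Char (x ⊕ unit i)
    holds =
      adjacent-⊕ x (isGenerator-unit (≤m⇒<N i≤m)) ,
      ⊕-preserves-adjacent x (subst IsGenerator (sym (c[l]⊕e[l]≡c[1+l] i)) (isGenerator-suffix (s≤s i≤m))) ,
      ⊕-preserves-adjacent x (subst IsGenerator (sym (u⊕v≡w⇒w⊕v≡u (c[l]⊕e[l]≡c[1+l] i)))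
                                (isGenerator-suffix (m≤n⇒m≤1+n i≤m)))

  Anchored : Vertex N → Set
  Anchored x = Fixed x × Fixed (x ⊕ suffix 0) × Fixed (x ⊕ unit (suc m))

  fixed-suffixes : ∀ {x} → Anchored x → ∀ i → i ≤ m → Fixed (x ⊕ suffix i) × Fixed (x ⊕ suffix (suc i))
  fixed-suffixes {x} (fx , fc₀ , _) zero _ =
    fc₀ , fixed-next-suffix x 0 (≤-trans (s≤s z≤n) 2≤m) fx fc₀ (λ _ ())
  fixed-suffixes {x} anchored@(fx , _ , fe) (suc i) 1+i≤m
    with fixed-suffixes anchored i (≤-trans (n≤1+n i) 1+i≤m) | suc (suc i) ≤? m
  ... | fi , f1+i | yes 2+i≤m = f1+i , fixed-next-suffix x (suc i) 2+i≤m fx f1+i (λ { _ refl → fi })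
  ... | _ , f1+i  | no 2+i≰m  = f1+i , subst (λ i′ → Fixed (x ⊕ suffix (suc i′)))
                                        (≤-antisym (≤-pred (≰⇒> 2+i≰m)) 1+i≤m)
                                        (subst (λ v → Fixed (x ⊕ v)) (sym suffix-last) fe)

  fixed-neighbours : ∀ {x g} → Anchored x → IsGenerator g → Fixed (x ⊕ g)
  fixed-neighbours {x} anchored@(fx , _ , fe) (is-unit {a} a<N refl) with a ≤? m
  ... | yes a≤m = let fa , f1+a = fixed-suffixes anchored a a≤m in fixed-unit x a a≤m fx fa f1+a
  ... | no a≰m  = subst (λ a′ → Fixed (x ⊕ unit a′)) (≤-antisym (≰⇒> a≰m) (≤-pred a<N)) fe
  fixed-neighbours anchored (is-suffix {l} l≤m refl) = proj₁ (fixed-suffixes anchored l l≤m)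

  fixed-corner : ∀ {x} → Anchored x → Fixed (x ⊕ suffix 0 ⊕ unit (suc m))
  fixed-corner {x} (fx , fc₀ , fe) = subst Fixed (sym (⊕-assoc x c₀ eₗ))
    (fixed-if-unique x (c₀ ⊕ eₗ) Char preserved unique holds)
    where
    c₀ eₗ : Vertex N
    c₀ = suffix 0
    eₗ = unit (suc m)
    Char : Vertex N → Set
    Char y = Adjacent (x ⊕ c₀) y × Adjacent (x ⊕ eₗ) y × y ≢ x
    preserved : ∀ {y} → Char y → Char (to y)
    preserved (xc₀~y , xeₗ~y , y≢x) = fixed⇒adjacent fc₀ xc₀~y , fixed⇒adjacent fe xeₗ~y , fixed⇒distinct fx y≢x
    unique : ∀ g → Char (x ⊕ g) → g ≡ c₀ ⊕ eₗ
    unique g (xc₀~y , xeₗ~y , y≢x)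
      with commonNeighbours-ē 2≤m (⊕-reflects-adjacent x xc₀~y)
             (subst IsGenerator (sym [c₀⊕g]⊕ē≡eₗ⊕g) (⊕-reflects-adjacent x xeₗ~y))
      where
      [c₀⊕g]⊕ē≡eₗ⊕g : c₀ ⊕ g ⊕ ⟦ ē (suc m) ⟧ ≡ eₗ ⊕ g
      [c₀⊕g]⊕ē≡eₗ⊕g = begin
        c₀ ⊕ g ⊕ ⟦ ē (suc m) ⟧ ≡⟨ cong (c₀ ⊕ g ⊕_) (c[0]⊕e[a]≡ē[a] (suc m)) ⟨
        (c₀ ⊕ g) ⊕ (c₀ ⊕ eₗ)   ≡⟨ [x⊕a]⊕[x⊕b]≡a⊕b c₀ g eₗ ⟩
        g ⊕ eₗ                 ≡⟨ ⊕-comm g eₗ ⟩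
        eₗ ⊕ g                 ∎
        where open ≡-Reasoning
    ... | inj₁ c₀⊕g≡c₀ = ⊥-elim (y≢x (trans (cong (x ⊕_) g≡zeros) (⊕-identityʳ x)))
      where
      g≡zeros : g ≡ zeros
      g≡zeros = ⊕-cancelˡ c₀ (trans c₀⊕g≡c₀ (sym (⊕-identityʳ c₀)))
    ... | inj₂ c₀⊕g≡eₗ = trans (sym (x⊕[x⊕y]≡y c₀ g)) (cong (c₀ ⊕_) c₀⊕g≡eₗ)
    holds : Char (x ⊕ (c₀ ⊕ eₗ))
    holds =
      ⊕-preserves-adjacent x (subst IsGenerator (sym (x⊕[x⊕y]≡y c₀ eₗ)) (isGenerator-unit ≤-refl)) ,
      ⊕-preserves-adjacent x (subst IsGenerator (sym eₗ⊕[c₀⊕eₗ]≡c₀) (isGenerator-suffix z≤n)) ,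
      λ eq → zeros≢⟦⟧ (ē (suc m)) 0 (s≤s z≤n) 1+n≢0
               (sym (trans (sym (c[0]⊕e[a]≡ē[a] (suc m))) (⊕-cancelˡ x (trans eq (sym (⊕-identityʳ x))))))
      where
      eₗ⊕[c₀⊕eₗ]≡c₀ : eₗ ⊕ (c₀ ⊕ eₗ) ≡ c₀
      eₗ⊕[c₀⊕eₗ]≡c₀ = trans (cong (eₗ ⊕_) (⊕-comm c₀ eₗ)) (x⊕[x⊕y]≡y eₗ c₀)

  anchored-⊕-c₀ : ∀ {x} → Anchored x → Anchored (x ⊕ suffix 0)
  anchored-⊕-c₀ {x} anchored@(fx , fc₀ , _) =
    fc₀ , subst Fixed (sym (x⊕y⊕y≡x x (suffix 0))) fx , fixed-corner anchored

  anchored-⊕-eₗ : ∀ {x} → Anchored x → Anchored (x ⊕ unit (suc m))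
  anchored-⊕-eₗ {x} anchored@(fx , _ , fe) =
    fe , subst Fixed (x⊕a⊕b≡x⊕b⊕a x (suffix 0) (unit (suc m))) (fixed-corner anchored) ,
    subst Fixed (sym (x⊕y⊕y≡x x (unit (suc m)))) fx

  anchored-step : ∀ {x d} → Anchored x → IsGenerator d → Anchored (x ⊕ d)
  anchored-step {x} {d} anchored gd =
    fixed-neighbours anchored gd ,
    subst Fixed (x⊕a⊕b≡x⊕b⊕a x (suffix 0) d) (fixed-neighbours (anchored-⊕-c₀ anchored) gd) ,
    subst Fixed (x⊕a⊕b≡x⊕b⊕a x (unit (suc m)) d) (fixed-neighbours (anchored-⊕-eₗ anchored) gd)

  all-fixed : Fixed zeros → Fixed (suffix 0) → Fixed (unit (suc m)) → ∀ v → Fixed v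
  all-fixed f₀ fc₀ fe v = proj₁ (⊕-unit-induction Anchored anchored-zeros
    (λ k k<N anchored → anchored-step anchored (isGenerator-unit k<N)) v)
    where
    anchored-zeros : Anchored zeros
    anchored-zeros = f₀ , subst Fixed (sym (⊕-identityˡ (suffix 0))) fc₀ ,
                     subst Fixed (sym (⊕-identityˡ (unit (suc m)))) fe

theorem7p2 : (n : ℕ) → 4 ≤ n → DetAtMost n 3
theorem7p2 (suc (suc m)) (s≤s (s≤s 2≤m)) = S , s≤s (s≤s (s≤s z≤n)) , determining
  where
  S : List (Vertex (suc (suc m)))
  S = zeros ∷ suffix 0 ∷ unit (suc m) ∷ []
  determining : IsDeterminingSet (suc (suc m)) S
  determining φ fixes = Rigidity.all-fixed m 2≤m φ
    (fixes _ (here refl)) (fixes _ (there (here refl))) (fixes _ (there (there (here refl))))
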